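{- Let $p$ be a prime and let $A,B,C$ be integers with $\gcd(A,B)=1$, $AB\neq 0$ and $A^4+B^2=C^p$. Then there exists a prime $\ell > 3$ which divides $C$. -}

module Defs where

module Submission where

-- If a prime q ≤ 3 divided C, then q² ∣ Cᵖ = A⁴ + B² since p ≥ 2. But x² + y² ≡ 0 (mod 3)
-- forces 3 ∣ x and 3 ∣ y, and x² + y² ≡ 0 (mod 4) forces x and y even; with x = A², y = B
-- this gives a common prime factor of A and B. Since A⁴ + B² ≥ 2, C has some prime factor.

open import Defs
open import Data.Nat using (ℕ; _>_)
open import Data.Nat.Primality using (Prime)
open import Data.Integer using (ℤ; +_; _*_; _+_; _^_; 0ℤ)
open import Data.Integer.GCD using (gcd)
open import Data.Integer.Divisibility using (_∣_)
open import Data.Product using (∃-syntax; _×_)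
open import Relation.Binary.PropositionalEquality using (_≡_; _≢_)

open import Data.Nat as ℕ using (zero; suc; _%_; _<_; _≤_; z≤n; s≤s; NonZero)
import Data.Nat.Properties as ℕ
open import Data.Nat.Divisibility as ℕ using (m%n≡0⇒n∣m; n∣m⇒m%n≡0; m∣m*n; ∣-trans; *-pres-∣)
open import Data.Nat.DivMod using (%-distribˡ-+; %-distribˡ-*; m%n<n; m∣n⇒o%n%m≡o%m)
open import Data.Nat.Coprimality using (Coprime; gcd≡1⇒coprime)
open import Data.Nat.Primality using (¬prime[0]; ¬prime[1]; euclidsLemma)
open import Data.Nat.Primality.Factorisation using (factorise)
open import Data.Integer as ℤ using (∣_∣; sign; _◃_)
import Data.Integer.Properties as ℤ
import Data.Sign as Sign
open import Data.Sign.Properties using (s*s≡+)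
open import Data.List using ([]; _∷_)
open import Data.Nat.ListAction using (product)
open import Data.List.Relation.Unary.All using (_∷_)
open import Data.Product using (_,_)
open import Data.Sum using (inj₁; inj₂)
open import Data.Empty using (⊥; ⊥-elim)
open import Relation.Binary.PropositionalEquality using (refl; sym; trans; cong; cong₂; subst; module ≡-Reasoning)

%-distrib-sumOfSquares : ∀ d m n .{{_ : NonZero d}} →
  (m ℕ.* m ℕ.+ n ℕ.* n) % d ≡ ((m % d) ℕ.* (m % d) ℕ.+ (n % d) ℕ.* (n % d)) % d
%-distrib-sumOfSquares d m n = begin
  (m ℕ.* m ℕ.+ n ℕ.* n) % d
    ≡⟨ %-distribˡ-+ (m ℕ.* m) (n ℕ.* n) d ⟩
  ((m ℕ.* m) % d ℕ.+ (n ℕ.* n) % d) % d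
    ≡⟨ cong₂ (λ x y → (x ℕ.+ y) % d) (%-distribˡ-* m m d) (%-distribˡ-* n n d) ⟩
  ((m % d) ℕ.* (m % d) % d ℕ.+ (n % d) ℕ.* (n % d) % d) % d
    ≡⟨ %-distribˡ-+ ((m % d) ℕ.* (m % d)) ((n % d) ℕ.* (n % d)) d ⟨
  ((m % d) ℕ.* (m % d) ℕ.+ (n % d) ℕ.* (n % d)) % d
    ∎
  where open ≡-Reasoning

sumOfSquares%3≡0⇒≡0 : ∀ {r s} → r < 3 → s < 3 →
  (r ℕ.* r ℕ.+ s ℕ.* s) % 3 ≡ 0 → r ≡ 0 × s ≡ 0
sumOfSquares%3≡0⇒≡0 {0} {0} _ _ _ = refl , refl
sumOfSquares%3≡0⇒≡0 {0} {1} _ _ ()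
sumOfSquares%3≡0⇒≡0 {0} {2} _ _ ()
sumOfSquares%3≡0⇒≡0 {1} {0} _ _ ()
sumOfSquares%3≡0⇒≡0 {1} {1} _ _ ()
sumOfSquares%3≡0⇒≡0 {1} {2} _ _ ()
sumOfSquares%3≡0⇒≡0 {2} {0} _ _ ()
sumOfSquares%3≡0⇒≡0 {2} {1} _ _ ()
sumOfSquares%3≡0⇒≡0 {2} {2} _ _ ()
sumOfSquares%3≡0⇒≡0 {suc (suc (suc _))} (s≤s (s≤s (s≤s ()))) _ _
sumOfSquares%3≡0⇒≡0 {_} {suc (suc (suc _))} _ (s≤s (s≤s (s≤s ()))) _

sumOfSquares%4≡0⇒even : ∀ {r s} → r < 4 → s < 4 →
  (r ℕ.* r ℕ.+ s ℕ.* s) % 4 ≡ 0 → r % 2 ≡ 0 × s % 2 ≡ 0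
sumOfSquares%4≡0⇒even {0} {0} _ _ _ = refl , refl
sumOfSquares%4≡0⇒even {0} {2} _ _ _ = refl , refl
sumOfSquares%4≡0⇒even {2} {0} _ _ _ = refl , refl
sumOfSquares%4≡0⇒even {2} {2} _ _ _ = refl , refl
sumOfSquares%4≡0⇒even {0} {1} _ _ ()
sumOfSquares%4≡0⇒even {0} {3} _ _ ()
sumOfSquares%4≡0⇒even {1} {0} _ _ ()
sumOfSquares%4≡0⇒even {1} {1} _ _ ()
sumOfSquares%4≡0⇒even {1} {2} _ _ ()
sumOfSquares%4≡0⇒even {1} {3} _ _ ()
sumOfSquares%4≡0⇒even {2} {1} _ _ ()
sumOfSquares%4≡0⇒even {2} {3} _ _ ()
sumOfSquares%4≡0⇒even {3} {0} _ _ ()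
sumOfSquares%4≡0⇒even {3} {1} _ _ ()
sumOfSquares%4≡0⇒even {3} {2} _ _ ()
sumOfSquares%4≡0⇒even {3} {3} _ _ ()
sumOfSquares%4≡0⇒even {suc (suc (suc (suc _)))} (s≤s (s≤s (s≤s (s≤s ())))) _ _
sumOfSquares%4≡0⇒even {_} {suc (suc (suc (suc _)))} _ (s≤s (s≤s (s≤s (s≤s ())))) _

3∣sumOfSquares⇒3∣both : ∀ m n → 3 ℕ.∣ m ℕ.* m ℕ.+ n ℕ.* n → 3 ℕ.∣ m × 3 ℕ.∣ n
3∣sumOfSquares⇒3∣both m n 3∣m²+n²
  with sumOfSquares%3≡0⇒≡0 (m%n<n m 3) (m%n<n n 3)
         (trans (sym (%-distrib-sumOfSquares 3 m n)) (n∣m⇒m%n≡0 _ 3 3∣m²+n²))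
... | m%3≡0 , n%3≡0 = m%n≡0⇒n∣m m 3 m%3≡0 , m%n≡0⇒n∣m n 3 n%3≡0

4∣sumOfSquares⇒2∣both : ∀ m n → 4 ℕ.∣ m ℕ.* m ℕ.+ n ℕ.* n → 2 ℕ.∣ m × 2 ℕ.∣ n
4∣sumOfSquares⇒2∣both m n 4∣m²+n²
  with sumOfSquares%4≡0⇒even (m%n<n m 4) (m%n<n n 4)
         (trans (sym (%-distrib-sumOfSquares 4 m n)) (n∣m⇒m%n≡0 _ 4 4∣m²+n²))
... | m%4%2≡0 , n%4%2≡0 = even m m%4%2≡0 , even n n%4%2≡0
  where
  even : ∀ x → x % 4 % 2 ≡ 0 → 2 ℕ.∣ x
  even x x%4%2≡0 = m%n≡0⇒n∣m x 2 (trans (sym (m∣n⇒o%n%m≡o%m 2 4 x (ℕ.divides 2 refl))) x%4%2≡0)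

prime∣n*n⇒prime∣n : ∀ {p n} → Prime p → p ℕ.∣ n ℕ.* n → p ℕ.∣ n
prime∣n*n⇒prime∣n {n = n} pp p∣n² with euclidsLemma n n pp p∣n²
... | inj₁ p∣n = p∣n
... | inj₂ p∣n = p∣n

coprime⇒¬prime∣both : ∀ {m n p} → Coprime m n → Prime p → p ℕ.∣ m → p ℕ.∣ n → ⊥
coprime⇒¬prime∣both coprime pp p∣m p∣n = ¬prime[1] (subst Prime (coprime (p∣m , p∣n)) pp)

∃-prime∣ : ∀ {n} → 1 < n → ∃[ p ] (Prime p × p ℕ.∣ n)
∃-prime∣ {n} 1<n with factorise n {{ℕ.>-nonZero (ℕ.<-trans (s≤s z≤n) 1<n)}}
... | record { factors = [] ; isFactorisation = n≡1 } = ⊥-elim (ℕ.<⇒≢ 1<n (sym n≡1))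
... | record { factors = p ∷ ps ; isFactorisation = n≡p*ps ; factorsPrime = pp ∷ _ } =
  p , pp , subst (p ℕ.∣_) (sym n≡p*ps) (m∣m*n (product ps))

1<m^n⇒1<m : ∀ m n → 1 < m ℕ.^ n → 1 < m
1<m^n⇒1<m m n 1<mⁿ = ℕ.≰⇒> λ m≤1 →
  ℕ.<⇒≱ 1<mⁿ (subst (m ℕ.^ n ≤_) (ℕ.^-zeroˡ n) (ℕ.^-monoˡ-≤ n m≤1))

1<m⁴+n² : ∀ m n → m ℕ.* n ≢ 0 → 1 < m ℕ.* m ℕ.* (m ℕ.* m) ℕ.+ n ℕ.* n
1<m⁴+n² 0 _ mn≢0 = ⊥-elim (mn≢0 refl)
1<m⁴+n² (suc m) 0 mn≢0 = ⊥-elim (mn≢0 (ℕ.*-zeroʳ (suc m)))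
1<m⁴+n² (suc _) (suc _) _ = ℕ.+-mono-≤ (s≤s z≤n) (s≤s z≤n)

∣⇒square∣power : ∀ {d m} k → d ℕ.∣ m → d ℕ.* d ℕ.∣ m ℕ.^ (2 ℕ.+ k)
∣⇒square∣power {m = m} k d∣m = *-pres-∣ d∣m (∣-trans d∣m (m∣m*n (m ℕ.^ k)))

prime∣base⇒>3 : ∀ {a b c k q} → Coprime a b →
  a ℕ.* a ℕ.* (a ℕ.* a) ℕ.+ b ℕ.* b ≡ c ℕ.^ (2 ℕ.+ k) → Prime q → q ℕ.∣ c → q > 3
prime∣base⇒>3 {q = 0} _ _ pq _ = ⊥-elim (¬prime[0] pq)
prime∣base⇒>3 {q = 1} _ _ pq _ = ⊥-elim (¬prime[1] pq)
prime∣base⇒>3 {a} {b} {k = k} {q = 2} coprime eq p2 2∣c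
  with 4∣sumOfSquares⇒2∣both (a ℕ.* a) b (subst (4 ℕ.∣_) (sym eq) (∣⇒square∣power k 2∣c))
... | 2∣a² , 2∣b = ⊥-elim (coprime⇒¬prime∣both coprime p2 (prime∣n*n⇒prime∣n p2 2∣a²) 2∣b)
prime∣base⇒>3 {a} {b} {k = k} {q = 3} coprime eq p3 3∣c
  with 3∣sumOfSquares⇒3∣both (a ℕ.* a) b
         (subst (3 ℕ.∣_) (sym eq) (∣-trans (m∣m*n 3) (∣⇒square∣power k 3∣c)))
... | 3∣a² , 3∣b = ⊥-elim (coprime⇒¬prime∣both coprime p3 (prime∣n*n⇒prime∣n p3 3∣a²) 3∣b)
prime∣base⇒>3 {q = suc (suc (suc (suc _)))} _ _ _ _ = s≤s (s≤s (s≤s (s≤s z≤n)))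

∃-prime>3∣base : ∀ {a b c k} → Coprime a b → a ℕ.* b ≢ 0 →
  a ℕ.* a ℕ.* (a ℕ.* a) ℕ.+ b ℕ.* b ≡ c ℕ.^ (2 ℕ.+ k) → ∃[ q ] (Prime q × q > 3 × q ℕ.∣ c)
∃-prime>3∣base {a} {b} {c} {k} coprime ab≢0 eq
  with ∃-prime∣ (1<m^n⇒1<m c (2 ℕ.+ k) (subst (1 <_) eq (1<m⁴+n² a b ab≢0)))
... | q , pq , q∣c = q , pq , prime∣base⇒>3 {k = k} coprime eq pq q∣c , q∣c

abs-^ : ∀ i n → ∣ i ^ n ∣ ≡ ∣ i ∣ ℕ.^ n
abs-^ i zero = refl
abs-^ i (suc n) = trans (ℤ.abs-* i (i ^ n)) (cong (∣ i ∣ ℕ.*_) (abs-^ i n))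

i^2≡+∣i∣*∣i∣ : ∀ i → i ^ 2 ≡ + (∣ i ∣ ℕ.* ∣ i ∣)
i^2≡+∣i∣*∣i∣ i = begin
  i * (i * ℤ.1ℤ)                         ≡⟨ cong (i *_) (ℤ.*-identityʳ i) ⟩
  sign i Sign.* sign i ◃ ∣ i ∣ ℕ.* ∣ i ∣ ≡⟨ cong (_◃ ∣ i ∣ ℕ.* ∣ i ∣) (s*s≡+ (sign i)) ⟩
  Sign.+ ◃ ∣ i ∣ ℕ.* ∣ i ∣               ≡⟨ ℤ.+◃n≡+n _ ⟩
  + (∣ i ∣ ℕ.* ∣ i ∣)                    ∎
  where open ≡-Reasoning

i⁴+j²≡+∣i∣⁴+∣j∣² : ∀ i j → i ^ 4 + j ^ 2 ≡ + (∣ i ∣ ℕ.* ∣ i ∣ ℕ.* (∣ i ∣ ℕ.* ∣ i ∣) ℕ.+ ∣ j ∣ ℕ.* ∣ j ∣)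
i⁴+j²≡+∣i∣⁴+∣j∣² i j = cong₂ _+_ i⁴≡+∣i∣⁴ (i^2≡+∣i∣*∣i∣ j)
  where
  open ≡-Reasoning
  i⁴≡+∣i∣⁴ : i ^ 4 ≡ + (∣ i ∣ ℕ.* ∣ i ∣ ℕ.* (∣ i ∣ ℕ.* ∣ i ∣))
  i⁴≡+∣i∣⁴ = begin
    i ^ 4                      ≡⟨ ℤ.^-*-assoc i 2 2 ⟨
    (i ^ 2) ^ 2                ≡⟨ cong (_^ 2) (i^2≡+∣i∣*∣i∣ i) ⟩
    (+ (∣ i ∣ ℕ.* ∣ i ∣)) ^ 2  ≡⟨ i^2≡+∣i∣*∣i∣ (+ (∣ i ∣ ℕ.* ∣ i ∣)) ⟩
    + (∣ i ∣ ℕ.* ∣ i ∣ ℕ.* (∣ i ∣ ℕ.* ∣ i ∣))  ∎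

lemma4p3 : (p : ℕ) → Prime p → (A B C : ℤ) → gcd A B ≡ + 1 → A * B ≢ 0ℤ → A ^ 4 + B ^ 2 ≡ C ^ p → ∃[ ℓ ] (Prime ℓ × ℓ > 3 × (+ ℓ) ∣ C)
lemma4p3 0 p0 _ _ _ _ _ _ = ⊥-elim (¬prime[0] p0)
lemma4p3 1 p1 _ _ _ _ _ _ = ⊥-elim (¬prime[1] p1)
lemma4p3 (suc (suc k)) _ A B C gcd≡1 AB≢0 eq = ∃-prime>3∣base {k = k} coprime ∣A∣*∣B∣≢0 eqℕ
  where
  coprime : Coprime ∣ A ∣ ∣ B ∣
  coprime = gcd≡1⇒coprime (ℤ.+-injective gcd≡1)
  ∣A∣*∣B∣≢0 : ∣ A ∣ ℕ.* ∣ B ∣ ≢ 0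
  ∣A∣*∣B∣≢0 ab≡0 = AB≢0 (ℤ.∣i∣≡0⇒i≡0 (trans (ℤ.abs-* A B) ab≡0))
  eqℕ : ∣ A ∣ ℕ.* ∣ A ∣ ℕ.* (∣ A ∣ ℕ.* ∣ A ∣) ℕ.+ ∣ B ∣ ℕ.* ∣ B ∣ ≡ ∣ C ∣ ℕ.^ (2 ℕ.+ k)
  eqℕ = trans (cong ∣_∣ (trans (sym (i⁴+j²≡+∣i∣⁴+∣j∣² A B)) eq)) (abs-^ C (2 ℕ.+ k))
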